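{- Let $G$ be a cactus graph on $n$ vertices with at least two cycles, and suppose $G$ contains a $4$-cycle $C_4$. Then $\operatorname{Z}(\overline{G})\leq n-3$.
   Context: All graphs are finite, simple and undirected. A cactus graph is a connected graph in which any two simple cycles have at most one vertex in common. $\overline{G}$ denotes the complement of $G$ (same vertex set; distinct vertices adjacent iff not adjacent in $G$). Zero forcing: given an initial set $B\subseteq V(G)$ of blue vertices (all others white), a blue vertex with exactly one white neighbor may turn that neighbor blue; $B$ is a zero forcing set if repeated application makes all vertices blue. $\operatorname{Z}(G)$ is the minimum size of a zero forcing set of $G$. -}

module Defs where

open import Data.Nat using (ℕ; _≤_; _∸_)
open import Data.Fin using (Fin; _≟_)
open import Data.Fin.Subset using (Subset; _∈_; ∣_∣)
open import Data.Bool using (Bool; true; false; not; _∧_)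
open import Data.List using (List; []; _∷_; _++_; [_]; length)
open import Data.List.Relation.Unary.Unique.Propositional using (Unique)
open import Data.List.Relation.Binary.Pointwise using ()
import Data.List.Membership.Propositional as LM
open import Data.Product using (Σ; ∃; ∃-syntax; _×_; _,_)
open import Data.Sum using (_⊎_)
open import Relation.Nullary using (¬_; ⌊_⌋)
open import Relation.Binary.PropositionalEquality using (_≡_; _≢_)

Adjacency : ℕ → Set
Adjacency n = Fin n → Fin n → Bool

Adj : ∀ {n} → Adjacency n → Fin n → Fin n → Set
Adj a u v = a u v ≡ true

record IsSimpleGraph {n : ℕ} (a : Adjacency n) : Set where
  field
    symmetric   : ∀ u v → a u v ≡ a v u
    irreflexive : ∀ u → a u u ≡ false

complement : ∀ {n} → Adjacency n → Adjacency n
complement a u v = not (a u v) ∧ not ⌊ u ≟ v ⌋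

data Walk {n : ℕ} (a : Adjacency n) : Fin n → Fin n → Set where
  stop : ∀ {u} → Walk a u u
  step : ∀ {u v w} → Adj a u v → Walk a v w → Walk a u w

Connected : ∀ {n} → Adjacency n → Set
Connected a = ∀ u v → Walk a u v

data Consec {A : Set} (x y : A) : List A → Set where
  here  : ∀ {zs} → Consec x y (x ∷ y ∷ zs)
  there : ∀ {z zs} → Consec x y zs → Consec x y (z ∷ zs)

data Chain {A : Set} (R : A → A → Set) : List A → Set where
  []  : Chain R []
  [-] : ∀ {x} → Chain R (x ∷ [])
  _∷_ : ∀ {x y zs} → R x y → Chain R (y ∷ zs) → Chain R (x ∷ y ∷ zs)

-- A simple cycle v0 v1 ... vk v0 (k ≥ 2, i.e. at least 3 distinct vertices)
record Cycle {n : ℕ} (a : Adjacency n) : Set where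
  constructor cycle
  field
    start    : Fin n
    rest     : List (Fin n)
    long     : 2 ≤ length rest
    distinct : Unique (start ∷ rest)
    closed   : Chain (Adj a) (start ∷ rest ++ [ start ])
open Cycle public

vertices : ∀ {n} {a : Adjacency n} → Cycle a → List (Fin n)
vertices c = start c ∷ rest c

closedSeq : ∀ {n} {a : Adjacency n} → Cycle a → List (Fin n)
closedSeq c = start c ∷ rest c ++ [ start c ]

cycleLength : ∀ {n} {a : Adjacency n} → Cycle a → ℕ
cycleLength c = length (vertices c)

OnCycle : ∀ {n} {a : Adjacency n} → Fin n → Cycle a → Set
OnCycle v c = v LM.∈ vertices c

CycleEdge : ∀ {n} {a : Adjacency n} → Cycle a → Fin n → Fin n → Set
CycleEdge c u v = Consec u v (closedSeq c) ⊎ Consec v u (closedSeq c)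

-- two cycles are the same subgraph iff they have the same edge set
SameCycle : ∀ {n} {a : Adjacency n} → Cycle a → Cycle a → Set
SameCycle c d = ∀ u v → (CycleEdge c u v → CycleEdge d u v) × (CycleEdge d u v → CycleEdge c u v)

IsCactus : ∀ {n} → Adjacency n → Set
IsCactus {n} a =
  Connected a ×
  (∀ (c d : Cycle a) → ¬ SameCycle c d →
     ∀ (u v : Fin n) → OnCycle u c → OnCycle v c → OnCycle u d → OnCycle v d → u ≡ v)

AtLeastTwoCycles : ∀ {n} → Adjacency n → Set
AtLeastTwoCycles a = Σ (Cycle a) λ c → Σ (Cycle a) λ d → ¬ SameCycle c d

ContainsC4 : ∀ {n} → Adjacency n → Set
ContainsC4 a = Σ (Cycle a) λ c → cycleLength c ≡ 4

data Blue {n : ℕ} (a : Adjacency n) (B : Subset n) : Fin n → Set where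
  initial : ∀ {v} → v ∈ B → Blue a B v
  force   : ∀ {u v} → Blue a B u → Adj a u v →
            (∀ w → Adj a u w → w ≢ v → Blue a B w) → Blue a B v

IsZeroForcingSet : ∀ {n} → Adjacency n → Subset n → Set
IsZeroForcingSet a B = ∀ v → Blue a B v

-- Z(G) ≤ k  :⇔  there is a zero forcing set of size at most k (Z is a minimum)
ZLe : ∀ {n} → Adjacency n → ℕ → Set
ZLe {n} a k = ∃[ B ] (IsZeroForcingSet a B × ∣ B ∣ ≤ k)

-- A second cycle cannot have two vertices on the 4-cycle, so some vertex lies off it, and a walk
-- from there yields an edge from an off-square vertex w to a vertex p₀ of the square p₀ p₁ p₂ p₃.
-- In a cactus the square has no chords and w is not adjacent to p₂, since either would close a
-- cycle sharing the edge p₀ p₁ with the square. Hence in the complement, with every vertex except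
-- p₀, p₁, p₂ initially blue, p₃ forces p₁ (its only white neighbour), then w forces p₂, and then
-- p₂ forces p₀.
module Submission where

open import Defs
open import Data.Nat using (ℕ; _∸_; _≤_; _<_; s≤s; z≤n)
open import Data.Nat.Properties using (≤-trans; ≤-reflexive; +-comm; m+n≤o⇒m≤o∸n)
open import Data.Bool using (true; false)
open import Data.Fin using (Fin; _≟_)
open import Data.Fin.Properties using (any?)
open import Data.Fin.Subset using (_∈_; ∣_∣; ⊤; _-_)
open import Data.Fin.Subset.Properties using (∈⊤; ∣⊤∣≡n; x∈p∧x≢y⇒x∈p-y; x∈p⇒∣p-x∣<∣p∣)
open import Data.List using ([]; _∷_; _++_; [_])
import Data.List.Membership.Propositional as List
open import Data.List.Membership.Propositional.Properties using (∈-++⁻)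
import Data.List.Membership.DecPropositional as DecMembership
open import Data.List.Relation.Binary.Subset.Propositional using (_⊆_)
open import Data.List.Relation.Unary.Any using (here; there)
open import Data.List.Relation.Unary.All using ([]; _∷_)
open import Data.List.Relation.Unary.All.Properties using (All¬⇒¬Any)
open import Data.List.Relation.Unary.AllPairs using ([]; _∷_)
open import Data.List.Relation.Unary.Unique.Propositional using (Unique)
open import Data.Product using (Σ; ∃; ∃₂; _×_; _,_; proj₁; proj₂; map₂)
open import Data.Sum using (inj₁; inj₂)
open import Data.Empty using (⊥-elim)
open import Function using (_∘_; id)
open import Relation.Nullary using (¬_; yes; no)
open import Relation.Nullary.Decidable using (¬?; decidable-stable)
open import Relation.Unary using (Decidable)
open import Relation.Binary.PropositionalEquality using (_≡_; _≢_; refl; trans; ≢-sym; subst)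

private
  variable
    n : ℕ
    a : Adjacency n
    u v w x y z : Fin n

complement-adj : (a : Adjacency n) → ¬ Adj a u v → u ≢ v → Adj (complement a) u v
complement-adj {u = u} {v} a u≁v u≢v with a u v | u ≟ v
... | true  | _       = ⊥-elim (u≁v refl)
... | false | yes u≡v = ⊥-elim (u≢v u≡v)
... | false | no _    = refl

complement-¬adj : (a : Adjacency n) → Adj a u v → ¬ Adj (complement a) u v
complement-¬adj _ u~v u≁ᶜv rewrite u~v with () ← u≁ᶜv

∈⊤-x-y-z : v ≢ x → v ≢ y → v ≢ z → v ∈ ⊤ - x - y - z
∈⊤-x-y-z v≢x v≢y v≢z = x∈p∧x≢y⇒x∈p-y (x∈p∧x≢y⇒x∈p-y (x∈p∧x≢y⇒x∈p-y ∈⊤ v≢x) v≢y) v≢z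

∣⊤-x-y-z∣≤n∸3 : {x y z : Fin n} → y ≢ x → z ≢ x → z ≢ y → ∣ ⊤ - x - y - z ∣ ≤ n ∸ 3
∣⊤-x-y-z∣≤n∸3 {n} {x} {y} {z} y≢x z≢x z≢y =
  m+n≤o⇒m≤o∸n _ (≤-trans (≤-reflexive (+-comm _ 3))
    (≤-trans (s≤s (s≤s shrink-z)) (≤-trans (s≤s shrink-y) shrink-x)))
  where
  shrink-x : ∣ ⊤ - x ∣ < n
  shrink-x = subst (∣ ⊤ - x ∣ <_) (∣⊤∣≡n n) (x∈p⇒∣p-x∣<∣p∣ {n} {x} {⊤} ∈⊤)
  shrink-y : ∣ ⊤ - x - y ∣ < ∣ ⊤ - x ∣
  shrink-y = x∈p⇒∣p-x∣<∣p∣ (x∈p∧x≢y⇒x∈p-y ∈⊤ y≢x)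
  shrink-z : ∣ ⊤ - x - y - z ∣ < ∣ ⊤ - x - y ∣
  shrink-z = x∈p⇒∣p-x∣<∣p∣ (x∈p∧x≢y⇒x∈p-y (x∈p∧x≢y⇒x∈p-y ∈⊤ z≢x) z≢y)

module _ (h : Adjacency n) {p₀ p₁ p₂ : Fin n} where

  ⊤-p₀-p₁-p₂-isZeroForcing : u ∈ ⊤ - p₀ - p₁ - p₂ → w ∈ ⊤ - p₀ - p₁ - p₂ →
    Adj h u p₁ → ¬ Adj h u p₀ → ¬ Adj h u p₂ →
    Adj h w p₂ → ¬ Adj h w p₀ →
    Adj h p₂ p₀ →
    IsZeroForcingSet h (⊤ - p₀ - p₁ - p₂)
  ⊤-p₀-p₁-p₂-isZeroForcing {u} {w} u∈B w∈B u~p₁ u≁p₀ u≁p₂ w~p₂ w≁p₀ p₂~p₀ = blue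
    where
    Blue′ : Fin n → Set
    Blue′ = Blue h (⊤ - p₀ - p₁ - p₂)

    blue₁ : Blue′ p₁
    blue₁ = force (initial u∈B) u~p₁ λ x u~x x≢p₁ →
      initial (∈⊤-x-y-z (λ { refl → u≁p₀ u~x }) x≢p₁ (λ { refl → u≁p₂ u~x }))

    blue₂ : Blue′ p₂
    blue₂ = force (initial w∈B) w~p₂ neighbours-blue
      where
      neighbours-blue : ∀ x → Adj h w x → x ≢ p₂ → Blue′ x
      neighbours-blue x w~x x≢p₂ with x ≟ p₁
      ... | yes refl = blue₁
      ... | no x≢p₁  = initial (∈⊤-x-y-z (λ { refl → w≁p₀ w~x }) x≢p₁ x≢p₂)

    blue-≢p₀ : ∀ {x} → x ≢ p₀ → Blue′ x
    blue-≢p₀ {x} x≢p₀ with x ≟ p₁ | x ≟ p₂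
    ... | yes refl | _        = blue₁
    ... | no _     | yes refl = blue₂
    ... | no x≢p₁  | no x≢p₂  = initial (∈⊤-x-y-z x≢p₀ x≢p₁ x≢p₂)

    blue : ∀ x → Blue′ x
    blue x with x ≟ p₀
    ... | yes refl = force blue₂ p₂~p₀ λ _ _ → blue-≢p₀
    ... | no x≢p₀  = blue-≢p₀ x≢p₀

module _ {A : Set} where

  consec⇒∈ˡ : ∀ {x y : A} {xs} → Consec x y xs → x List.∈ xs
  consec⇒∈ˡ here       = here refl
  consec⇒∈ˡ (there xy) = there (consec⇒∈ˡ xy)

  consec⇒∈ʳ : ∀ {x y : A} {xs} → Consec x y xs → y List.∈ xs
  consec⇒∈ʳ here       = there (here refl)
  consec⇒∈ʳ (there xy) = there (consec⇒∈ʳ xy)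

  ∈⇒consec-∷ʳ : ∀ {x z : A} xs → x List.∈ xs → ∃ λ y → Consec x y (xs ++ [ z ])
  ∈⇒consec-∷ʳ (_ ∷ [])     (here refl) = _ , here
  ∈⇒consec-∷ʳ (_ ∷ y ∷ _)  (here refl) = y , here
  ∈⇒consec-∷ʳ (_ ∷ xs)     (there x∈) = map₂ there (∈⇒consec-∷ʳ xs x∈)

  ∈-closed⇒∈ : ∀ {v x : A} xs → v List.∈ x ∷ xs ++ [ x ] → v List.∈ x ∷ xs
  ∈-closed⇒∈ xs (here v≡x) = here v≡x
  ∈-closed⇒∈ xs (there v∈) with ∈-++⁻ xs v∈
  ... | inj₁ v∈xs       = there v∈xs
  ... | inj₂ (here v≡x) = here v≡x

  rotate-unique : ∀ {p q r s : A} → Unique (p ∷ q ∷ r ∷ s ∷ []) → Unique (q ∷ r ∷ s ∷ p ∷ [])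
  rotate-unique ((p≢q ∷ p≢r ∷ p≢s ∷ []) ∷ (q≢r ∷ q≢s ∷ []) ∷ (r≢s ∷ []) ∷ [] ∷ []) =
    (q≢r ∷ q≢s ∷ ≢-sym p≢q ∷ []) ∷ (r≢s ∷ ≢-sym p≢r ∷ []) ∷ (≢-sym p≢s ∷ []) ∷ [] ∷ []

  rotate-chain : ∀ {R : A → A → Set} {p q r s} →
    Chain R (p ∷ q ∷ r ∷ s ∷ p ∷ []) → Chain R (q ∷ r ∷ s ∷ p ∷ q ∷ [])
  rotate-chain (pq ∷ qr ∷ rs ∷ sp ∷ [-]) = qr ∷ rs ∷ sp ∷ pq ∷ [-]

CycleEdge⇒OnCycle : (c : Cycle a) → CycleEdge c u v → OnCycle u c
CycleEdge⇒OnCycle c (inj₁ uv) = ∈-closed⇒∈ (rest c) (consec⇒∈ˡ uv)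
CycleEdge⇒OnCycle c (inj₂ vu) = ∈-closed⇒∈ (rest c) (consec⇒∈ʳ vu)

OnCycle⇒CycleEdge : (c : Cycle a) → OnCycle u c → ∃ λ v → CycleEdge c u v
OnCycle⇒CycleEdge c u∈c = map₂ inj₁ (∈⇒consec-∷ʳ (vertices c) u∈c)

OnCycle? : (c : Cycle a) → Decidable (λ v → OnCycle v c)
OnCycle? c v = DecMembership._∈?_ _≟_ v (vertices c)

SameCycle-sym : {c d : Cycle a} → SameCycle c d → SameCycle d c
SameCycle-sym c≈d u v = proj₂ (c≈d u v) , proj₁ (c≈d u v)

SameCycle-trans : {c d e : Cycle a} → SameCycle c d → SameCycle d e → SameCycle c e
SameCycle-trans c≈d d≈e u v = proj₁ (d≈e u v) ∘ proj₁ (c≈d u v) , proj₂ (c≈d u v) ∘ proj₂ (d≈e u v)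

OnCycle∧¬OnCycle⇒≉ : (c d : Cycle a) → OnCycle v c → ¬ OnCycle v d → ¬ SameCycle c d
OnCycle∧¬OnCycle⇒≉ c d v∈c v∉d c≈d =
  let (u , edge) = OnCycle⇒CycleEdge c v∈c in v∉d (CycleEdge⇒OnCycle d (proj₁ (c≈d _ u) edge))

another-cycle : AtLeastTwoCycles a → (d : Cycle a) → ¬ ¬ Σ (Cycle a) λ c → ¬ SameCycle c d
another-cycle (c₁ , c₂ , c₁≉c₂) d none =
  none (c₁ , λ c₁≈d → none (c₂ , λ c₂≈d →
    c₁≉c₂ (SameCycle-trans {c = c₁} {d} {c₂} c₁≈d (SameCycle-sym {c = c₂} {d} c₂≈d))))

exit-edge : {P : Fin n → Set} → Decidable P → Walk a x y → ¬ P x → P y →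
  ∃₂ λ u v → ¬ P u × P v × Adj a u v
exit-edge P? stop ¬Px Py = ⊥-elim (¬Px Py)
exit-edge P? (step {v = v} x~v walk) ¬Px Py with P? v
... | yes Pv  = _ , v , ¬Px , Pv , x~v
... | no ¬Pv  = exit-edge P? walk ¬Pv Py

record Square (a : Adjacency n) : Set where
  constructor square
  field
    p₀ p₁ p₂ p₃ : Fin n
    distinct    : Unique (p₀ ∷ p₁ ∷ p₂ ∷ p₃ ∷ [])
    closed      : Chain (Adj a) (p₀ ∷ p₁ ∷ p₂ ∷ p₃ ∷ p₀ ∷ [])
open Square

toCycle : Square a → Cycle a
toCycle q = cycle (p₀ q) (p₁ q ∷ p₂ q ∷ p₃ q ∷ []) (s≤s (s≤s z≤n)) (distinct q) (closed q)

fromCycle : (c : Cycle a) → cycleLength c ≡ 4 → Square a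
fromCycle (cycle p₀ (p₁ ∷ p₂ ∷ p₃ ∷ []) _ distinct closed) refl = square p₀ p₁ p₂ p₃ distinct closed

rotate : Square a → Square a
rotate q = square (p₁ q) (p₂ q) (p₃ q) (p₀ q) (rotate-unique (distinct q)) (rotate-chain (closed q))

rotate-⊆ : (q : Square a) → vertices (toCycle (rotate q)) ⊆ vertices (toCycle q)
rotate-⊆ q (here v≡p₁)                         = there (here v≡p₁)
rotate-⊆ q (there (here v≡p₂))                 = there (there (here v≡p₂))
rotate-⊆ q (there (there (here v≡p₃)))         = there (there (there (here v≡p₃)))
rotate-⊆ q (there (there (there (here v≡p₀)))) = here v≡p₀

align : (q : Square a) → OnCycle v (toCycle q) →
  Σ (Square a) λ q′ → v ≡ p₀ q′ × vertices (toCycle q′) ⊆ vertices (toCycle q)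
align q (here v≡p₀)                         = q , v≡p₀ , id
align q (there (here v≡p₁))                 = rotate q , v≡p₁ , rotate-⊆ q
align q (there (there (here v≡p₂)))         =
  rotate (rotate q) , v≡p₂ , rotate-⊆ q ∘ rotate-⊆ (rotate q)
align q (there (there (there (here v≡p₃)))) =
  rotate (rotate (rotate q)) , v≡p₃ , rotate-⊆ q ∘ rotate-⊆ (rotate q) ∘ rotate-⊆ (rotate (rotate q))

module Cactus {n : ℕ} {a : Adjacency n} (simple : IsSimpleGraph a) (cactus : IsCactus a) where
  open IsSimpleGraph simple

  adj-sym : Adj a u v → Adj a v u
  adj-sym {u = u} {v} u~v = trans (symmetric v u) u~v

  shared-vertices-equal : (c d : Cycle a) → OnCycle v c → ¬ OnCycle v d →
    OnCycle x c → OnCycle y c → OnCycle x d → OnCycle y d → x ≡ y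
  shared-vertices-equal c d v∈c v∉d =
    proj₂ cactus c d (OnCycle∧¬OnCycle⇒≉ c d v∈c v∉d) _ _

  cycle-leaves : (c d : Cycle a) → ¬ SameCycle c d → ∃ λ v → OnCycle v c × ¬ OnCycle v d
  cycle-leaves (cycle _ [] () _ _)
  cycle-leaves c@(cycle u (v ∷ _) _ ((u≢v ∷ _) ∷ _) _) d c≉d with OnCycle? d u | OnCycle? d v
  ... | no u∉d | _      = u , here refl , u∉d
  ... | yes _  | no v∉d = v , there (here refl) , v∉d
  ... | yes u∈d | yes v∈d =
    ⊥-elim (u≢v (proj₂ cactus c d c≉d u v (here refl) (there (here refl)) u∈d v∈d))

  -- Only ¬¬ of a cycle distinct from d is available (SameCycle is undecidable), but an off
  -- vertex is a decidable property over Fin n.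
  vertex-off : AtLeastTwoCycles a → (d : Cycle a) → ∃ λ v → ¬ OnCycle v d
  vertex-off two d = decidable-stable (any? λ v → ¬? (OnCycle? d v)) λ none →
    another-cycle two d λ (c , c≉d) → let (v , _ , v∉d) = cycle-leaves c d c≉d in none (v , v∉d)

  square-chordless : (q : Square a) → ¬ Adj a (p₀ q) (p₂ q)
  square-chordless q@(square p₀ p₁ p₂ p₃
      ((p₀≢p₁ ∷ p₀≢p₂ ∷ p₀≢p₃ ∷ []) ∷ (p₁≢p₂ ∷ p₁≢p₃ ∷ []) ∷ (p₂≢p₃ ∷ []) ∷ [] ∷ [])
      (p₀~p₁ ∷ p₁~p₂ ∷ _)) p₀~p₂ =
    p₀≢p₁ (shared-vertices-equal (toCycle q) triangle p₃∈q p₃∉triangle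
      (here refl) (there (here refl)) (here refl) (there (here refl)))
    where
    triangle : Cycle a
    triangle = cycle p₀ (p₁ ∷ p₂ ∷ []) (s≤s (s≤s z≤n))
      ((p₀≢p₁ ∷ p₀≢p₂ ∷ []) ∷ (p₁≢p₂ ∷ []) ∷ [] ∷ []) (p₀~p₁ ∷ p₁~p₂ ∷ adj-sym p₀~p₂ ∷ [-])
    p₃∈q : OnCycle p₃ (toCycle q)
    p₃∈q = there (there (there (here refl)))
    p₃∉triangle : ¬ OnCycle p₃ triangle
    p₃∉triangle = All¬⇒¬Any (≢-sym p₀≢p₃ ∷ ≢-sym p₁≢p₃ ∷ ≢-sym p₂≢p₃ ∷ [])

  module Off-square {q : Square a} {w} (w∉q : ¬ OnCycle w (toCycle q)) where
    w≢p₀ : w ≢ p₀ q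
    w≢p₀ w≡p₀ = w∉q (here w≡p₀)
    w≢p₁ : w ≢ p₁ q
    w≢p₁ w≡p₁ = w∉q (there (here w≡p₁))
    w≢p₂ : w ≢ p₂ q
    w≢p₂ w≡p₂ = w∉q (there (there (here w≡p₂)))

  no-opposite-neighbours : (q : Square a) → ¬ OnCycle w (toCycle q) →
    Adj a w (p₀ q) → ¬ Adj a w (p₂ q)
  no-opposite-neighbours {w = w} q@(square p₀ p₁ p₂ p₃
      ((p₀≢p₁ ∷ p₀≢p₂ ∷ _) ∷ (p₁≢p₂ ∷ _) ∷ _) (p₀~p₁ ∷ p₁~p₂ ∷ _)) w∉q w~p₀ w~p₂ =
    p₀≢p₁ (shared-vertices-equal quadrangle (toCycle q) (here refl) w∉q
      (there (here refl)) (there (there (here refl))) (here refl) (there (here refl)))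
    where
    open Off-square {q} w∉q
    quadrangle : Cycle a
    quadrangle = cycle w (p₀ ∷ p₁ ∷ p₂ ∷ []) (s≤s (s≤s z≤n))
      ((w≢p₀ ∷ w≢p₁ ∷ w≢p₂ ∷ []) ∷
       (p₀≢p₁ ∷ p₀≢p₂ ∷ []) ∷ (p₁≢p₂ ∷ []) ∷ [] ∷ [])
      (w~p₀ ∷ p₀~p₁ ∷ p₁~p₂ ∷ adj-sym w~p₂ ∷ [-])

  pendant-square⇒Z≤n∸3 : (q : Square a) → ¬ OnCycle w (toCycle q) →
    Adj a w (p₀ q) → ZLe (complement a) (n ∸ 3)
  pendant-square⇒Z≤n∸3 {w = w} q@(square p₀ p₁ p₂ p₃
      ((p₀≢p₁ ∷ p₀≢p₂ ∷ p₀≢p₃ ∷ []) ∷ (p₁≢p₂ ∷ p₁≢p₃ ∷ []) ∷ (p₂≢p₃ ∷ []) ∷ [] ∷ [])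
      (_ ∷ _ ∷ p₂~p₃ ∷ p₃~p₀ ∷ [-])) w∉q w~p₀ =
    ⊤ - p₀ - p₁ - p₂ ,
    ⊤-p₀-p₁-p₂-isZeroForcing (complement a)
      (∈⊤-x-y-z (≢-sym p₀≢p₃) (≢-sym p₁≢p₃) (≢-sym p₂≢p₃)) (∈⊤-x-y-z w≢p₀ w≢p₁ w≢p₂)
      (complement-adj a (square-chordless (rotate q) ∘ adj-sym) (≢-sym p₁≢p₃))
      (complement-¬adj a p₃~p₀)
      (complement-¬adj a (adj-sym p₂~p₃))
      (complement-adj a (no-opposite-neighbours q w∉q w~p₀) w≢p₂)
      (complement-¬adj a w~p₀)
      (complement-adj a (square-chordless q ∘ adj-sym) (≢-sym p₀≢p₂)) ,
    ∣⊤-x-y-z∣≤n∸3 (≢-sym p₀≢p₁) (≢-sym p₀≢p₂) (≢-sym p₁≢p₂)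
    where
    open Off-square {q} w∉q

proposition4p5 : (n : ℕ) (a : Adjacency n) → IsSimpleGraph a → IsCactus a →
    AtLeastTwoCycles a → ContainsC4 a → ZLe (complement a) (n ∸ 3)
proposition4p5 n a simple cactus two (c , c-is-square) =
  let q = fromCycle c c-is-square
      (x , x∉q) = vertex-off two (toCycle q)
      (w , y , w∉q , y∈q , w~y) =
        exit-edge (OnCycle? (toCycle q)) (proj₁ cactus x (p₀ q)) x∉q (here refl)
      (q′ , y≡p₀ , q′⊆q) = align q y∈q
  in pendant-square⇒Z≤n∸3 q′ (w∉q ∘ q′⊆q) (subst (Adj a w) y≡p₀ w~y)
  where open Cactus simple cactus
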